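{- Let $\mathcal{C}$ be a category, let $R,S,T$ be monads on $\mathcal{C}$, let $\sigma \colon SR \Rightarrow RS$ be a weak distributive law, and let $\lambda \colon TS \Rightarrow ST$ and $\tau \colon TR \Rightarrow RT$ be natural transformations. Assume $\lambda$ satisfies $\lambda \circ T\eta^S = \eta^S T$ and $\lambda \circ T\mu^S = \mu^S T \circ S\lambda \circ \lambda S$, and assume the Yang–Baxter equation $\sigma T \circ S\tau \circ \lambda R = R\lambda \circ \tau S \circ T\sigma$ holds. Let $\kappa^\sigma \triangleq R\mu^S \circ \sigma S \circ \eta^S RS \colon RS \Rightarrow RS$. Then $$\kappa^\sigma T \circ R\lambda \circ \tau S = R\lambda \circ \tau S \circ T\kappa^\sigma.$$
   Context: A monad is $(T,\eta^T,\mu^T)$ with unit $\eta^T\colon 1\Rightarrow T$ and multiplication $\mu^T \colon TT \Rightarrow T$. For monads $R,S$, a natural transformation $\sigma \colon SR \Rightarrow RS$ is a weak distributive law if $\sigma \circ S\eta^R = \eta^R S$, $\sigma \circ S\mu^R = \mu^R S \circ R\sigma \circ \sigma R$, and $\sigma \circ \mu^S R = R\mu^S \circ \sigma S \circ S\sigma$. -}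

module Defs where

open import Level using (Level; _⊔_; suc)
open import Relation.Binary using (IsEquivalence)

record Category (o ℓ e : Level) : Set (suc (o ⊔ ℓ ⊔ e)) where
  infixr 9 _∘_
  infix  4 _≈_
  field
    Obj   : Set o
    _⇒_   : Obj → Obj → Set ℓ
    _≈_   : ∀ {A B} → A ⇒ B → A ⇒ B → Set e
    id    : ∀ {A} → A ⇒ A
    _∘_   : ∀ {A B C} → B ⇒ C → A ⇒ B → A ⇒ C
    ≈-equiv : ∀ {A B} → IsEquivalence (_≈_ {A} {B})
    ∘-resp-≈ : ∀ {A B C} {f h : B ⇒ C} {g i : A ⇒ B} → f ≈ h → g ≈ i → f ∘ g ≈ h ∘ i
    assoc : ∀ {A B C D} {f : A ⇒ B} {g : B ⇒ C} {h : C ⇒ D} → (h ∘ g) ∘ f ≈ h ∘ (g ∘ f)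
    identityˡ : ∀ {A B} {f : A ⇒ B} → id ∘ f ≈ f
    identityʳ : ∀ {A B} {f : A ⇒ B} → f ∘ id ≈ f

module CT {o ℓ e : Level} (C : Category o ℓ e) where
  open Category C

  record Endofunctor : Set (o ⊔ ℓ ⊔ e) where
    field
      F₀ : Obj → Obj
      F₁ : ∀ {A B} → A ⇒ B → F₀ A ⇒ F₀ B
      identity : ∀ {A} → F₁ (id {A}) ≈ id
      homomorphism : ∀ {A B D} {f : A ⇒ B} {g : B ⇒ D} → F₁ (g ∘ f) ≈ F₁ g ∘ F₁ f
      F-resp-≈ : ∀ {A B} {f g : A ⇒ B} → f ≈ g → F₁ f ≈ F₁ g

  open Endofunctor

  record NatTrans (F G : Endofunctor) : Set (o ⊔ ℓ ⊔ e) where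
    field
      η : ∀ X → F₀ F X ⇒ F₀ G X
      commute : ∀ {X Y} (f : X ⇒ Y) → η Y ∘ F₁ F f ≈ F₁ G f ∘ η X

  open NatTrans

  IdF : Endofunctor
  IdF = record
    { F₀ = λ X → X ; F₁ = λ f → f
    ; identity = IsEquivalence.refl ≈-equiv
    ; homomorphism = IsEquivalence.refl ≈-equiv
    ; F-resp-≈ = λ p → p }

  -- Composite G ∘ F  (written "G F" in the paper)
  _○_ : Endofunctor → Endofunctor → Endofunctor
  G ○ F = record
    { F₀ = λ X → F₀ G (F₀ F X)
    ; F₁ = λ f → F₁ G (F₁ F f)
    ; identity = IsEquivalence.trans ≈-equiv (F-resp-≈ G (identity F)) (identity G)
    ; homomorphism = IsEquivalence.trans ≈-equiv (F-resp-≈ G (homomorphism F)) (homomorphism G)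
    ; F-resp-≈ = λ p → F-resp-≈ G (F-resp-≈ F p) }

  record Monad : Set (o ⊔ ℓ ⊔ e) where
    field
      F : Endofunctor
      unit : NatTrans IdF F
      mult : NatTrans (F ○ F) F
    T₀ = F₀ F
    T₁ : ∀ {A B} → A ⇒ B → T₀ A ⇒ T₀ B
    T₁ = F₁ F
    ηᵀ : ∀ X → X ⇒ T₀ X
    ηᵀ = η unit
    μᵀ : ∀ X → T₀ (T₀ X) ⇒ T₀ X
    μᵀ = η mult
    field
      assoc-μ : ∀ X → μᵀ X ∘ T₁ (μᵀ X) ≈ μᵀ X ∘ μᵀ (T₀ X)
      unitˡ   : ∀ X → μᵀ X ∘ T₁ (ηᵀ X) ≈ id
      unitʳ   : ∀ X → μᵀ X ∘ ηᵀ (T₀ X) ≈ id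

  open Monad

  record IsWeakDistributiveLaw (R S : Monad) (σ : NatTrans (F S ○ F R) (F R ○ F S)) : Set (o ⊔ e) where
    field
      σ-unitR : ∀ X → η σ X ∘ T₁ S (ηᵀ R X) ≈ ηᵀ R (T₀ S X)
      σ-multR : ∀ X → η σ X ∘ T₁ S (μᵀ R X)
                      ≈ μᵀ R (T₀ S X) ∘ (T₁ R (η σ X) ∘ η σ (T₀ R X))
      σ-multS : ∀ X → η σ X ∘ μᵀ S (T₀ R X)
                      ≈ T₁ R (μᵀ S X) ∘ (η σ (T₀ S X) ∘ T₁ S (η σ X))

  κ : (R S : Monad) (σ : NatTrans (F S ○ F R) (F R ○ F S)) → ∀ X → T₀ R (T₀ S X) ⇒ T₀ R (T₀ S X)
  κ R S σ X = T₁ R (μᵀ S X) ∘ (η σ (T₀ S X) ∘ ηᵀ S (T₀ R (T₀ S X)))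

{-# OPTIONS --safe #-}
-- Write ν := σ ∘ η^S R : R ⇒ RS, so that κ^σ = Rμ^S ∘ νS, and θ := Rλ ∘ τS : TRS ⇒ RST.
-- The multiplication law of λ moves θ past TRμ^S, turning it into Rμ^S T ∘ RSλ ∘ θS;
-- the Yang–Baxter equation together with the unit law of λ gives θ ∘ Tν = νT ∘ τ;
-- and ν is natural.
module Submission where

open import Level using (Level; _⊔_)
open import Relation.Binary.Bundles using (Setoid)
import Relation.Binary.Reasoning.Setoid as SetoidReasoning
open import Defs

module HomReasoning {o ℓ e : Level} (C : Category o ℓ e) where
  open Category C

  hom-setoid : Obj → Obj → Setoid ℓ e
  hom-setoid A B = record { Carrier = A ⇒ B ; _≈_ = _≈_ ; isEquivalence = ≈-equiv }

  module _ {A B : Obj} where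
    open Setoid (hom-setoid A B) public using (refl; sym; trans)
    open SetoidReasoning (hom-setoid A B) public

  infixr 4 refl⟩∘⟨_
  infixl 5 _⟩∘⟨refl

  refl⟩∘⟨_ : ∀ {A B D} {f : B ⇒ D} {g h : A ⇒ B} → g ≈ h → f ∘ g ≈ f ∘ h
  refl⟩∘⟨ p = ∘-resp-≈ refl p

  _⟩∘⟨refl : ∀ {A B D} {f g : B ⇒ D} {h : A ⇒ B} → f ≈ g → f ∘ h ≈ g ∘ h
  p ⟩∘⟨refl = ∘-resp-≈ p refl

module Lemmas {o ℓ e : Level} (C : Category o ℓ e) where
  open Category C
  open CT C
  open HomReasoning C
  open Monad
  open NatTrans
  open Endofunctor

  module _ (R : Endofunctor) (S : Monad) (σ : NatTrans (F S ○ R) (R ○ F S)) where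

    ν : ∀ X → F₀ R X ⇒ F₀ R (T₀ S X)
    ν X = η σ X ∘ ηᵀ S (F₀ R X)

    ν-natural : ∀ {X Y} (f : X ⇒ Y) → ν Y ∘ F₁ R f ≈ F₁ R (T₁ S f) ∘ ν X
    ν-natural {X} {Y} f = begin
      (η σ Y ∘ ηᵀ S (F₀ R Y)) ∘ F₁ R f      ≈⟨ assoc ⟩
      η σ Y ∘ (ηᵀ S (F₀ R Y) ∘ F₁ R f)      ≈⟨ refl⟩∘⟨ commute (unit S) (F₁ R f) ⟩
      η σ Y ∘ (T₁ S (F₁ R f) ∘ ηᵀ S (F₀ R X)) ≈⟨ sym assoc ⟩
      (η σ Y ∘ T₁ S (F₁ R f)) ∘ ηᵀ S (F₀ R X) ≈⟨ commute σ f ⟩∘⟨refl ⟩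
      (F₁ R (T₁ S f) ∘ η σ X) ∘ ηᵀ S (F₀ R X) ≈⟨ assoc ⟩
      F₁ R (T₁ S f) ∘ ν X                    ∎

  module _ (T : Endofunctor) (S : Monad) where

    RespectsUnit : NatTrans (T ○ F S) (F S ○ T) → Set (o ⊔ e)
    RespectsUnit λ' = ∀ X → η λ' X ∘ F₁ T (ηᵀ S X) ≈ ηᵀ S (F₀ T X)

    RespectsMult : NatTrans (T ○ F S) (F S ○ T) → Set (o ⊔ e)
    RespectsMult λ' = ∀ X → η λ' X ∘ F₁ T (μᵀ S X)
                            ≈ μᵀ S (F₀ T X) ∘ (T₁ S (η λ' X) ∘ η λ' (T₀ S X))

  module _ (R T : Endofunctor) (S : Monad) where

    YangBaxter : NatTrans (F S ○ R) (R ○ F S) → NatTrans (T ○ F S) (F S ○ T)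
               → NatTrans (T ○ R) (R ○ T) → Set (o ⊔ e)
    YangBaxter σ λ' τ = ∀ X → η σ (F₀ T X) ∘ (T₁ S (η τ X) ∘ η λ' (F₀ R X))
                              ≈ F₁ R (η λ' X) ∘ (η τ (T₀ S X) ∘ F₁ T (η σ X))

    module _ (λ' : NatTrans (T ○ F S) (F S ○ T)) (τ : NatTrans (T ○ R) (R ○ T)) where

      θ : ∀ X → F₀ T (F₀ R (T₀ S X)) ⇒ F₀ R (T₀ S (F₀ T X))
      θ X = F₁ R (η λ' X) ∘ η τ (T₀ S X)

      θ-μ : RespectsMult T S λ' → ∀ X
          → θ X ∘ F₁ T (F₁ R (μᵀ S X))
            ≈ F₁ R (μᵀ S (F₀ T X)) ∘ (F₁ R (T₁ S (η λ' X)) ∘ θ (T₀ S X))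
      θ-μ λ-μ X = begin
        (F₁ R λX ∘ η τ (T₀ S X)) ∘ F₁ T (F₁ R (μᵀ S X))   ≈⟨ assoc ⟩
        F₁ R λX ∘ (η τ (T₀ S X) ∘ F₁ T (F₁ R (μᵀ S X)))   ≈⟨ refl⟩∘⟨ commute τ (μᵀ S X) ⟩
        F₁ R λX ∘ (F₁ R (F₁ T (μᵀ S X)) ∘ η τ SSX)        ≈⟨ sym assoc ⟩
        (F₁ R λX ∘ F₁ R (F₁ T (μᵀ S X))) ∘ η τ SSX        ≈⟨ sym (homomorphism R) ⟩∘⟨refl ⟩
        F₁ R (λX ∘ F₁ T (μᵀ S X)) ∘ η τ SSX               ≈⟨ F-resp-≈ R (λ-μ X) ⟩∘⟨refl ⟩
        F₁ R (μᵀ S (F₀ T X) ∘ (T₁ S λX ∘ η λ' (T₀ S X))) ∘ η τ SSX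
          ≈⟨ trans (homomorphism R) (refl⟩∘⟨ homomorphism R) ⟩∘⟨refl ⟩
        (F₁ R (μᵀ S (F₀ T X)) ∘ (F₁ R (T₁ S λX) ∘ F₁ R (η λ' (T₀ S X)))) ∘ η τ SSX
          ≈⟨ trans assoc (refl⟩∘⟨ assoc) ⟩
        F₁ R (μᵀ S (F₀ T X)) ∘ (F₁ R (T₁ S λX) ∘ θ (T₀ S X)) ∎
        where
        λX = η λ' X
        SSX = T₀ S (T₀ S X)

      θ-ν : (σ : NatTrans (F S ○ R) (R ○ F S)) → RespectsUnit T S λ' → YangBaxter σ λ' τ
          → ∀ X → θ X ∘ F₁ T (ν R S σ X) ≈ ν R S σ (F₀ T X) ∘ η τ X
      θ-ν σ λ-η yang-baxter X = begin
        (F₁ R (η λ' X) ∘ η τ (T₀ S X)) ∘ F₁ T (η σ X ∘ ηᵀ S RX)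
          ≈⟨ refl⟩∘⟨ homomorphism T ⟩
        (F₁ R (η λ' X) ∘ η τ (T₀ S X)) ∘ (F₁ T (η σ X) ∘ F₁ T (ηᵀ S RX))
          ≈⟨ trans (sym assoc) (assoc ⟩∘⟨refl) ⟩
        (F₁ R (η λ' X) ∘ (η τ (T₀ S X) ∘ F₁ T (η σ X))) ∘ F₁ T (ηᵀ S RX)
          ≈⟨ sym (yang-baxter X) ⟩∘⟨refl ⟩
        (η σ (F₀ T X) ∘ (T₁ S (η τ X) ∘ η λ' RX)) ∘ F₁ T (ηᵀ S RX)
          ≈⟨ trans assoc (refl⟩∘⟨ assoc) ⟩
        η σ (F₀ T X) ∘ (T₁ S (η τ X) ∘ (η λ' RX ∘ F₁ T (ηᵀ S RX)))
          ≈⟨ refl⟩∘⟨ refl⟩∘⟨ λ-η RX ⟩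
        η σ (F₀ T X) ∘ (T₁ S (η τ X) ∘ ηᵀ S (F₀ T RX))
          ≈⟨ refl⟩∘⟨ sym (commute (unit S) (η τ X)) ⟩
        η σ (F₀ T X) ∘ (ηᵀ S (F₀ R (F₀ T X)) ∘ η τ X)
          ≈⟨ sym assoc ⟩
        ν R S σ (F₀ T X) ∘ η τ X ∎
        where
        RX = F₀ R X

      θ-κ : (σ : NatTrans (F S ○ R) (R ○ F S))
          → RespectsUnit T S λ' → RespectsMult T S λ' → YangBaxter σ λ' τ → ∀ X
          → (F₁ R (μᵀ S (F₀ T X)) ∘ ν R S σ (T₀ S (F₀ T X))) ∘ θ X
            ≈ θ X ∘ F₁ T (F₁ R (μᵀ S X) ∘ ν R S σ (T₀ S X))
      θ-κ σ λ-η λ-μ yang-baxter X = sym (begin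
        θ X ∘ F₁ T (F₁ R (μᵀ S X) ∘ ν R S σ SX)
          ≈⟨ trans (refl⟩∘⟨ homomorphism T) (sym assoc) ⟩
        (θ X ∘ F₁ T (F₁ R (μᵀ S X))) ∘ F₁ T (ν R S σ SX)
          ≈⟨ θ-μ λ-μ X ⟩∘⟨refl ⟩
        (F₁ R (μᵀ S TX) ∘ (F₁ R (T₁ S (η λ' X)) ∘ θ SX)) ∘ F₁ T (ν R S σ SX)
          ≈⟨ trans assoc (refl⟩∘⟨ assoc) ⟩
        F₁ R (μᵀ S TX) ∘ (F₁ R (T₁ S (η λ' X)) ∘ (θ SX ∘ F₁ T (ν R S σ SX)))
          ≈⟨ refl⟩∘⟨ refl⟩∘⟨ θ-ν σ λ-η yang-baxter SX ⟩
        F₁ R (μᵀ S TX) ∘ (F₁ R (T₁ S (η λ' X)) ∘ (ν R S σ (F₀ T SX) ∘ η τ SX))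
          ≈⟨ refl⟩∘⟨ sym assoc ⟩
        F₁ R (μᵀ S TX) ∘ ((F₁ R (T₁ S (η λ' X)) ∘ ν R S σ (F₀ T SX)) ∘ η τ SX)
          ≈⟨ refl⟩∘⟨ sym (ν-natural R S σ (η λ' X)) ⟩∘⟨refl ⟩
        F₁ R (μᵀ S TX) ∘ ((ν R S σ (T₀ S TX) ∘ F₁ R (η λ' X)) ∘ η τ SX)
          ≈⟨ trans (refl⟩∘⟨ assoc) (sym assoc) ⟩
        (F₁ R (μᵀ S TX) ∘ ν R S σ (T₀ S TX)) ∘ θ X ∎)
        where
        SX = T₀ S X
        TX = F₀ T X

lemma4p2 : ∀ {o ℓ e : Level} (C : Category o ℓ e) → let open Category C in let open CT C in
    (R S T : Monad)
    (σ : NatTrans (Monad.F S ○ Monad.F R) (Monad.F R ○ Monad.F S))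
    (λ' : NatTrans (Monad.F T ○ Monad.F S) (Monad.F S ○ Monad.F T))
    (τ : NatTrans (Monad.F T ○ Monad.F R) (Monad.F R ○ Monad.F T))
    → IsWeakDistributiveLaw R S σ
    → (∀ X → NatTrans.η λ' X ∘ Monad.T₁ T (Monad.ηᵀ S X) ≈ Monad.ηᵀ S (Monad.T₀ T X))
    → (∀ X → NatTrans.η λ' X ∘ Monad.T₁ T (Monad.μᵀ S X)
             ≈ Monad.μᵀ S (Monad.T₀ T X) ∘ (Monad.T₁ S (NatTrans.η λ' X) ∘ NatTrans.η λ' (Monad.T₀ S X)))
    → (∀ X → NatTrans.η σ (Monad.T₀ T X) ∘ (Monad.T₁ S (NatTrans.η τ X) ∘ NatTrans.η λ' (Monad.T₀ R X))
             ≈ Monad.T₁ R (NatTrans.η λ' X) ∘ (NatTrans.η τ (Monad.T₀ S X) ∘ Monad.T₁ T (NatTrans.η σ X)))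
    → ∀ X → κ R S σ (Monad.T₀ T X) ∘ (Monad.T₁ R (NatTrans.η λ' X) ∘ NatTrans.η τ (Monad.T₀ S X))
            ≈ Monad.T₁ R (NatTrans.η λ' X) ∘ (NatTrans.η τ (Monad.T₀ S X) ∘ Monad.T₁ T (κ R S σ X))
lemma4p2 C R S T σ λ' τ _ λ-η λ-μ yang-baxter X =
  trans (θ-κ (F R) (F T) S λ' τ σ λ-η λ-μ yang-baxter X) assoc
  where
  open Category C using (assoc)
  open HomReasoning C using (trans)
  open Lemmas C
  open CT.Monad
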